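{- For integers $n,k$ with $n\ge 2$ and $1\le k<2^{n-1}$, the number $\sigma_{n,k}$ of separating families of $k$ proper bipartitions over an $n$-element set is $$\sigma_{n,k}=\sum_{i=1}^{n-1}(-1)^{n-1-i}\left[{n \atop i+1}\right]\binom{2^i-1}{k}.$$
   Context: A bipartition of a set $S$ is a partition of $S$ into at most two nonempty components; it is proper if it has exactly two components. A bipartition cuts two elements if they lie in different components. A family of bipartitions of $S$ is a separating family for $S$ if every two distinct elements of $S$ are cut by some bipartition in the family. $\sigma_{n,k}$ is the number of separating families consisting of $k$ distinct proper bipartitions of a fixed $n$-element set. $\left[{a \atop b}\right]$ denotes the unsigned Stirling number of the first kind (number of permutations of $a$ elements with exactly $b$ cycles). -}

module Defs where

open import Data.Nat using (ℕ; zero; suc; _+_; _*_; _∸_; _^_)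
open import Data.Integer using (ℤ; +_; -1ℤ) renaming (_*_ to _*ℤ_; _^_ to _^ℤ_)
import Data.Integer as ℤ
open import Data.Nat.Combinatorics using (_C_)
open import Data.Bool using (Bool; true; false)
import Data.Bool.Properties as BoolP
open import Data.Fin using (Fin) renaming (zero to fzero)
open import Data.Fin.Properties using (all?)
open import Data.Fin.Subset using (Subset; inside; outside; ∁; Nonempty; _∈_; _∉_)
open import Data.Fin.Subset.Properties using (nonempty?; _∈?_)
open import Data.Vec using (Vec; []; _∷_; lookup)
open import Data.List using (List; []; _∷_; map; _++_; filter; length; applyUpTo)
open import Data.List.Relation.Unary.Any using (Any)
  renaming (any? to anyL?)
open import Data.Product using (_×_)
open import Relation.Nullary using (¬_; Dec; ¬?)
open import Relation.Nullary.Decidable using (_×-dec_; _→-dec_)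
open import Relation.Binary.PropositionalEquality using (_≡_; _≢_)
import Data.Fin.Properties as FinP

allSubsets : (n : ℕ) → List (Subset n)
allSubsets zero    = [] ∷ []
allSubsets (suc n) = map (inside ∷_) (allSubsets n) ++ map (outside ∷_) (allSubsets n)

-- A proper bipartition of Fin n is an unordered pair {A , ∁ A} with both
-- components nonempty.  We represent it by one chosen component, namely the
-- component containing the element 0 (so that each proper bipartition is
-- represented exactly once).
IsProperBipRep : {n : ℕ} → Subset n → Set
IsProperBipRep {zero}  A = Nonempty A × Nonempty (∁ A)
IsProperBipRep {suc n} A = (fzero ∈ A) × (Nonempty A × Nonempty (∁ A))

isProperBipRep? : {n : ℕ} (A : Subset n) → Dec (IsProperBipRep A)
isProperBipRep? {zero}  A = nonempty? A ×-dec nonempty? (∁ A)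
isProperBipRep? {suc n} A =
  (fzero ∈? A) ×-dec (nonempty? A ×-dec nonempty? (∁ A))

properBips : (n : ℕ) → List (Subset n)
properBips n = filter isProperBipRep? (allSubsets n)

Cuts : {n : ℕ} → Subset n → Fin n → Fin n → Set
Cuts A i j = ¬ (lookup A i ≡ lookup A j)

cuts? : {n : ℕ} (A : Subset n) (i j : Fin n) → Dec (Cuts A i j)
cuts? A i j = ¬? (lookup A i BoolP.≟ lookup A j)

Separating : {n : ℕ} → List (Subset n) → Set
Separating {n} F = (i j : Fin n) → i ≢ j → Any (λ A → Cuts A i j) F

separating? : {n : ℕ} (F : List (Subset n)) → Dec (Separating F)
separating? F = all? λ i → all? λ j →
  ¬? (i FinP.≟ j) →-dec anyL? (λ A → cuts? A i j) F

-- all k-element sublists of a list (k-subsets, when the list has no repeats)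
combinations : {A : Set} → ℕ → List A → List (List A)
combinations zero    xs       = [] ∷ []
combinations (suc k) []       = []
combinations (suc k) (x ∷ xs) = map (x ∷_) (combinations k xs) ++ combinations (suc k) xs

σ : ℕ → ℕ → ℕ
σ n k = length (filter separating? (combinations k (properBips n)))

stirling1 : ℕ → ℕ → ℕ
stirling1 zero    zero    = 1
stirling1 zero    (suc k) = 0
stirling1 (suc n) zero    = 0
stirling1 (suc n) (suc k) = n * stirling1 n (suc k) + stirling1 n k

sumFromTo : ℕ → ℕ → (ℕ → ℤ) → ℤ
sumFromTo a b f = Data.List.foldr ℤ._+_ (+ 0) (applyUpTo (λ t → f (a + t)) (suc b ∸ a))
  where import Data.List

module Submission where

-- Count, more generally, the k-families of proper bipartitions of [n] that are unions of fibres
-- of a surjection c : [n] → [m] and separate every two points of a list S with distinct c-images.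
-- For S = [] these are the k-sets of proper bipartitions of the m fibres: (2^(m-1) - 1 choose k).
-- For S = p ∷ S′, a family separating S′ either separates p from all of S′ too, or fails to
-- separate p from exactly one q ∈ S′; the families of the second kind are those for the map that
-- merges the fibres of p and q.  So the count a(j, r), with j = |S| and r = m - j, satisfies
-- a(j+1, r) = a(j, r+1) - j a(j, r), which is solved by signed Stirling numbers of the first kind:
-- a(j, r) = Σᵢ s(j, i) (2^(r+i-1) - 1 choose k).  The theorem is the case c = id, S = [n], r = 0.

open import Algebra.Bundles using (AbelianGroup)
open import Data.Bool using (Bool; true; false; not)
open import Data.Bool.Properties using () renaming (_≟_ to _≟ᵇ_)
open import Data.Empty using (⊥-elim)
open import Data.Fin using (Fin; _≟_; punchIn; punchOut) renaming (zero to fzero; suc to fsuc)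
open import Data.Fin.Properties using (all?; ¬Fin0; punchOut-injective; punchOut-cong; punchOut-punchIn; punchInᵢ≢i)
open import Data.Fin.Subset using (Subset; inside; outside; ∁; _∈_; Nonempty)
open import Data.Fin.Subset.Properties using (_∈?_; nonempty?; drop-there)
open import Data.Integer using (ℤ; +_; -1ℤ; 1ℤ) renaming (_+_ to _+ℤ_; _*_ to _*ℤ_; _^_ to _^ℤ_)
import Data.Integer.Properties as ℤ
open import Data.Integer.Solver using (module +-*-Solver)
open import Data.List using (List; []; _∷_; _++_; map; filter; length; foldr; applyUpTo; allFin)
open import Data.List.Properties using (filter-≐; filter-++; filter-all; filter-none; length-++; length-map; length-tabulate)
import Data.List.Membership.Propositional as List
open import Data.List.Membership.Propositional.Properties
  using (∈-map⁺; ∈-map⁻; ∈-++⁺ˡ; ∈-++⁺ʳ; ∈-filter⁺; ∈-filter⁻; ∈-allFin)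
open import Data.List.Membership.Propositional.Properties.WithK using (unique∧set⇒bag)
open import Data.List.Relation.Binary.BagAndSetEquality using (∼bag⇒↭)
open import Data.List.Relation.Binary.Permutation.Propositional.Properties using (↭-length)
open import Data.List.Relation.Unary.All as All using (All; []; _∷_)
open import Data.List.Relation.Unary.All.Properties using (All¬⇒¬Any; ¬Any⇒All¬; ¬All⇒Any¬)
open import Data.List.Relation.Unary.Any as Any using (Any; here; there)
open import Data.List.Relation.Unary.AllPairs as AllPairs using (AllPairs; []; _∷_)
import Data.List.Relation.Unary.AllPairs.Properties as AllPairs
open import Data.List.Relation.Unary.Unique.Propositional using (Unique)
import Data.List.Relation.Unary.Unique.Propositional.Properties as Unique
open import Data.Nat using (ℕ; zero; suc; _+_; _*_; _∸_; _^_; _≤_; _<_; s≤s; z≤n)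
open import Data.Nat.Combinatorics using (_C_; nCk+nC[k+1]≡[n+1]C[k+1])
open import Data.Nat.ListAction using (sum)
open import Data.Nat.Properties
  using (+-suc; +-identityʳ; +-comm; *-zeroʳ; +-∸-comm; m^n>0; suc-injective; <-≤-connex; m<n⇒m<1+n; n<1+n)
open import Data.Product as Product using (_×_; _,_; proj₁; proj₂; curry)
open import Data.Sum using (_⊎_; inj₁; inj₂)
open import Data.Vec using ([]; _∷_; here; there; _[_]=_; lookup; tabulate)
open import Data.Vec.Properties
  using (lookup∘tabulate; tabulate∘lookup; tabulate-cong; tabulate-∘; lookup-map; []=⇒lookup; lookup⇒[]=)
open import Function using (_∘_; id; _⇔_; mk⇔)
open import Level using (0ℓ)
open import Relation.Nullary using (Dec; yes; no; ¬_)
open import Relation.Nullary.Decidable using (_×-dec_; _→-dec_; decidable-stable)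
open import Relation.Unary using (Pred; Decidable; _≐_; _∪_; _∩_)
open import Relation.Unary.Properties using (_∪?_; _∩?_)
open import Relation.Binary.PropositionalEquality
  using (_≡_; _≢_; _≗_; refl; sym; trans; cong; cong₂; subst; module ≡-Reasoning)
open import Algebra.Properties.Group (AbelianGroup.group ℤ.+-0-abelianGroup) using (∙-cancelʳ)
open import Defs

-- Counting in lists

count : {A : Set} {P : Pred A 0ℓ} → Decidable P → List A → ℕ
count P? xs = length (filter P? xs)

module _ {A : Set} {P : Pred A 0ℓ} (P? : Decidable P) where

  count-++ : ∀ xs ys → count P? (xs ++ ys) ≡ count P? xs + count P? ys
  count-++ xs ys = trans (cong length (filter-++ P? xs ys)) (length-++ (filter P? xs))

  count-all : ∀ {xs} → All P xs → count P? xs ≡ length xs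
  count-all = cong length ∘ filter-all P?

  count-none : ∀ {xs} → All (¬_ ∘ P) xs → count P? xs ≡ 0
  count-none = cong length ∘ filter-none P?

  count-map : {B : Set} (f : B → A) (xs : List B) → count P? (map f xs) ≡ count (P? ∘ f) xs
  count-map f [] = refl
  count-map f (x ∷ xs) with P? (f x)
  ... | yes _ = cong suc (count-map f xs)
  ... | no  _ = count-map f xs

module _ {A : Set} {P Q : Pred A 0ℓ} (P? : Decidable P) (Q? : Decidable Q) where

  count-≐ : P ≐ Q → ∀ xs → count P? xs ≡ count Q? xs
  count-≐ P≐Q = cong length ∘ filter-≐ P? Q? P≐Q

  count-∪ : (∀ {x} → P x → ¬ Q x) → ∀ xs → count (P? ∪? Q?) xs ≡ count P? xs + count Q? xs
  count-∪ disjoint [] = refl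
  count-∪ disjoint (x ∷ xs) with P? x | Q? x
  ... | yes p | yes q = ⊥-elim (disjoint p q)
  ... | yes _ | no  _ = cong suc (count-∪ disjoint xs)
  ... | no  _ | yes _ = trans (cong suc (count-∪ disjoint xs)) (sym (+-suc _ _))
  ... | no  _ | no  _ = count-∪ disjoint xs

module _ {A B : Set} {Q : B → Pred A 0ℓ} (Q? : ∀ b → Decidable (Q b)) where

  count-any : ∀ bs → (∀ {x b} → Q b x → AllPairs (λ b₁ b₂ → ¬ (Q b₁ x × Q b₂ x)) bs) →
              ∀ xs → count (λ x → Any.any? (λ b → Q? b x) bs) xs ≡ sum (map (λ b → count (Q? b) xs) bs)
  count-any [] _ xs = count-none (λ x → Any.any? (λ b → Q? b x) []) (All.universal (λ _ ()) xs)
  count-any (b ∷ bs) exclusive xs = begin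
    count (λ x → Any.any? (λ b → Q? b x) (b ∷ bs)) xs
      ≡⟨ count-≐ _ (Q? b ∪? λ x → Any.any? (λ b → Q? b x) bs) (Any.toSum , Any.fromSum) xs ⟩
    count (Q? b ∪? λ x → Any.any? (λ b → Q? b x) bs) xs
      ≡⟨ count-∪ (Q? b) _ (λ q → All¬⇒¬Any (All.map (λ excl q′ → excl (q , q′)) (AllPairs.head (exclusive q)))) xs ⟩
    count (Q? b) xs + count (λ x → Any.any? (λ b → Q? b x) bs) xs
      ≡⟨ cong (_+_ (count (Q? b) xs)) (count-any bs (AllPairs.tail ∘ exclusive) xs) ⟩
    count (Q? b) xs + sum (map (λ b → count (Q? b) xs) bs) ∎
    where open ≡-Reasoning

module _ {A : Set} {P : Pred A 0ℓ} (P? : Decidable P) where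

  count-combinations : ∀ k xs → count (All.all? P?) (combinations k xs) ≡ count P? xs C k
  count-combinations zero    xs       = refl
  count-combinations (suc k) []       = refl
  count-combinations (suc k) (x ∷ xs) = begin
    count (All.all? P?) (map (x ∷_) (combinations k xs) ++ combinations (suc k) xs)
      ≡⟨ count-++ (All.all? P?) (map (x ∷_) (combinations k xs)) (combinations (suc k) xs) ⟩
    count (All.all? P?) (map (x ∷_) (combinations k xs)) + count (All.all? P?) (combinations (suc k) xs)
      ≡⟨ cong₂ _+_ (count-map (All.all? P?) (x ∷_) (combinations k xs)) (count-combinations (suc k) xs) ⟩
    count (All.all? P? ∘ (x ∷_)) (combinations k xs) + count P? xs C suc k
      ≡⟨ pascal ⟩
    count P? (x ∷ xs) C suc k ∎
    where
    open ≡-Reasoning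
    pascal : count (All.all? P? ∘ (x ∷_)) (combinations k xs) + count P? xs C suc k ≡ count P? (x ∷ xs) C suc k
    pascal with P? x
    ... | yes px = trans
      (cong (_+ count P? xs C suc k)
            (trans (count-≐ _ (All.all? P?) (All.tail , (px ∷_)) (combinations k xs))
                   (count-combinations k xs)))
      (nCk+nC[k+1]≡[n+1]C[k+1] (count P? xs) k)
    ... | no ¬px = cong (_+ count P? xs C suc k)
      (count-none _ (All.universal (λ _ → ¬px ∘ All.head) (combinations k xs)))

allPairs-∈ : {A : Set} {R : A → A → Set} → (∀ {x y} → R x y → R y x) →
             ∀ {xs x y} → AllPairs R xs → x List.∈ xs → y List.∈ xs → x ≢ y → R x y
allPairs-∈ R-sym (_ ∷ _)   (here refl) (here refl) x≢x = ⊥-elim (x≢x refl)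
allPairs-∈ R-sym (Rx ∷ _)  (here refl) (there y∈)  _   = All.lookup Rx y∈
allPairs-∈ R-sym (Ry ∷ _)  (there x∈)  (here refl) _   = R-sym (All.lookup Ry x∈)
allPairs-∈ R-sym (_ ∷ Rxs) (there x∈)  (there y∈)  x≢y = allPairs-∈ R-sym Rxs x∈ y∈ x≢y

sum-map-const : {A : Set} (g : A → ℕ) {z : ℤ} {xs : List A} → All (λ x → + g x ≡ z) xs → + sum (map g xs) ≡ + length xs *ℤ z
sum-map-const g         []                           = refl
sum-map-const g {z} {x ∷ xs} (gx≡z ∷ gxs≡z) = begin
  + (g x + sum (map g xs))         ≡⟨ ℤ.pos-+ (g x) (sum (map g xs)) ⟩
  + g x +ℤ + sum (map g xs)        ≡⟨ cong₂ _+ℤ_ gx≡z (sum-map-const g gxs≡z) ⟩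
  z +ℤ + length xs *ℤ z            ≡⟨ cong (_+ℤ + length xs *ℤ z) (ℤ.*-identityˡ z) ⟨
  + 1 *ℤ z +ℤ + length xs *ℤ z     ≡⟨ ℤ.*-distribʳ-+ z (+ 1) (+ length xs) ⟨
  + suc (length xs) *ℤ z           ∎
  where open ≡-Reasoning

unique∧set⇒length≡ : {A : Set} {xs ys : List A} → Unique xs → Unique ys → (∀ {x} → x List.∈ xs ⇔ x List.∈ ys) →
                      length xs ≡ length ys
unique∧set⇒length≡ xs! ys! xs∼ys = ↭-length (∼bag⇒↭ (unique∧set⇒bag xs! ys! xs∼ys))

-- Subsets of Fin m

∷-injectiveʳ : ∀ {m} {b b′} {B B′ : Subset m} → b ∷ B ≡ b′ ∷ B′ → B ≡ B′
∷-injectiveʳ refl = refl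

allSubsets-unique : ∀ m → Unique (allSubsets m)
allSubsets-unique zero    = [] ∷ []
allSubsets-unique (suc m) =
  Unique.++⁺ (Unique.map⁺ ∷-injectiveʳ (allSubsets-unique m)) (Unique.map⁺ ∷-injectiveʳ (allSubsets-unique m)) disjoint
  where
  disjoint : ∀ {B} → ¬ (B List.∈ map (inside ∷_) (allSubsets m) × B List.∈ map (outside ∷_) (allSubsets m))
  disjoint (p , q) with ∈-map⁻ (inside ∷_) p | ∈-map⁻ (outside ∷_) q
  ... | _ , _ , refl | _ , _ , ()

∈-allSubsets : ∀ {m} (B : Subset m) → B List.∈ allSubsets m
∈-allSubsets []                = here refl
∈-allSubsets {suc m} (true ∷ B)  = ∈-++⁺ˡ (∈-map⁺ (inside ∷_) (∈-allSubsets B))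
∈-allSubsets {suc m} (false ∷ B) = ∈-++⁺ʳ (map (inside ∷_) (allSubsets m)) (∈-map⁺ (outside ∷_) (∈-allSubsets B))

length-allSubsets : ∀ m → length (allSubsets m) ≡ 2 ^ m
length-allSubsets zero    = refl
length-allSubsets (suc m) = begin
  length (map (inside ∷_) (allSubsets m) ++ map (outside ∷_) (allSubsets m))
    ≡⟨ length-++ (map (inside ∷_) (allSubsets m)) ⟩
  length (map (inside ∷_) (allSubsets m)) + length (map (outside ∷_) (allSubsets m))
    ≡⟨ cong₂ _+_ (length-map (inside ∷_) (allSubsets m)) (length-map (outside ∷_) (allSubsets m)) ⟩
  length (allSubsets m) + length (allSubsets m)
    ≡⟨ cong₂ _+_ (length-allSubsets m) (trans (length-allSubsets m) (sym (+-identityʳ (2 ^ m)))) ⟩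
  2 ^ suc m ∎
  where open ≡-Reasoning

count-allSubsets-suc : ∀ m {P : Pred (Subset (suc m)) 0ℓ} (P? : Decidable P) →
  count P? (allSubsets (suc m)) ≡ count (P? ∘ (inside ∷_)) (allSubsets m) + count (P? ∘ (outside ∷_)) (allSubsets m)
count-allSubsets-suc m P? = trans (count-++ P? (map (inside ∷_) (allSubsets m)) (map (outside ∷_) (allSubsets m)))
  (cong₂ _+_ (count-map P? (inside ∷_) (allSubsets m)) (count-map P? (outside ∷_) (allSubsets m)))

2^n∸1+2^n≡2^[1+n]∸1 : ∀ n → (2 ^ n ∸ 1) + 2 ^ n ≡ 2 ^ suc n ∸ 1
2^n∸1+2^n≡2^[1+n]∸1 n = begin
  (2 ^ n ∸ 1) + 2 ^ n        ≡⟨ cong (_+_ (2 ^ n ∸ 1)) (+-identityʳ (2 ^ n)) ⟨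
  (2 ^ n ∸ 1) + (2 ^ n + 0)  ≡⟨ +-∸-comm (2 ^ n + 0) (m^n>0 2 n) ⟨
  2 ^ suc n ∸ 1              ∎
  where open ≡-Reasoning

coNonempty-inside : ∀ {m} {B : Subset m} → Nonempty (∁ (inside ∷ B)) → Nonempty (∁ B)
coNonempty-inside (fsuc i , there i∈∁B) = i , i∈∁B

coNonempty-∷ : ∀ {m} {B : Subset m} b → Nonempty (∁ B) → Nonempty (∁ (b ∷ B))
coNonempty-∷ _ (i , i∈∁B) = fsuc i , there i∈∁B

count-coNonempty : ∀ m → count (nonempty? ∘ ∁) (allSubsets m) ≡ 2 ^ m ∸ 1
count-coNonempty zero    = refl
count-coNonempty (suc m) = begin
  count (nonempty? ∘ ∁) (allSubsets (suc m))
    ≡⟨ count-allSubsets-suc m (nonempty? ∘ ∁) ⟩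
  count (nonempty? ∘ ∁ ∘ (inside ∷_)) (allSubsets m) + count (nonempty? ∘ ∁ ∘ (outside ∷_)) (allSubsets m)
    ≡⟨ cong₂ _+_ inside-part outside-part ⟩
  (2 ^ m ∸ 1) + 2 ^ m
    ≡⟨ 2^n∸1+2^n≡2^[1+n]∸1 m ⟩
  2 ^ suc m ∸ 1 ∎
  where
  open ≡-Reasoning
  inside-part : count (nonempty? ∘ ∁ ∘ (inside ∷_)) (allSubsets m) ≡ 2 ^ m ∸ 1
  inside-part = trans (count-≐ (nonempty? ∘ ∁ ∘ (inside ∷_)) (nonempty? ∘ ∁) (coNonempty-inside , coNonempty-∷ inside) (allSubsets m))
                      (count-coNonempty m)
  outside-part : count (nonempty? ∘ ∁ ∘ (outside ∷_)) (allSubsets m) ≡ 2 ^ m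
  outside-part = trans (count-all (nonempty? ∘ ∁ ∘ (outside ∷_)) (All.universal (λ _ → fzero , here) (allSubsets m)))
                       (length-allSubsets m)

count-∈ : ∀ m (l : Fin (suc m)) → count (l ∈?_) (allSubsets (suc m)) ≡ 2 ^ m
count-∈ m fzero = begin
  count (fzero ∈?_) (allSubsets (suc m))
    ≡⟨ count-allSubsets-suc m (fzero ∈?_) ⟩
  count ((fzero ∈?_) ∘ (inside ∷_)) (allSubsets m) + count ((fzero ∈?_) ∘ (outside ∷_)) (allSubsets m)
    ≡⟨ cong₂ _+_ (trans (count-all ((fzero ∈?_) ∘ (inside ∷_)) (All.universal (λ _ → here) (allSubsets m))) (length-allSubsets m))
                 (count-none ((fzero ∈?_) ∘ (outside ∷_)) (All.universal (λ _ ()) (allSubsets m))) ⟩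
  2 ^ m + 0
    ≡⟨ +-identityʳ (2 ^ m) ⟩
  2 ^ m ∎
  where open ≡-Reasoning
count-∈ (suc m) (fsuc l) = begin
  count (fsuc l ∈?_) (allSubsets (suc (suc m)))
    ≡⟨ count-allSubsets-suc (suc m) (fsuc l ∈?_) ⟩
  count ((fsuc l ∈?_) ∘ (inside ∷_)) (allSubsets (suc m)) + count ((fsuc l ∈?_) ∘ (outside ∷_)) (allSubsets (suc m))
    ≡⟨ cong₂ _+_ (drop-head inside) (trans (drop-head outside) (sym (+-identityʳ (2 ^ m)))) ⟩
  2 ^ m + (2 ^ m + 0) ∎
  where
  open ≡-Reasoning
  drop-head : ∀ b → count ((fsuc l ∈?_) ∘ (b ∷_)) (allSubsets (suc m)) ≡ 2 ^ m
  drop-head b = trans (count-≐ ((fsuc l ∈?_) ∘ (b ∷_)) (l ∈?_) (drop-there , there) (allSubsets (suc m)))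
                      (count-∈ m l)

∈∩coNonempty? : ∀ {m} (l : Fin m) → Decidable ((l ∈_) ∩ (Nonempty ∘ ∁))
∈∩coNonempty? l = (l ∈?_) ∩? (nonempty? ∘ ∁)

count-∈∩coNonempty : ∀ m (l : Fin (suc m)) → count (∈∩coNonempty? l) (allSubsets (suc m)) ≡ 2 ^ m ∸ 1
count-∈∩coNonempty m fzero = begin
  count (∈∩coNonempty? fzero) (allSubsets (suc m))
    ≡⟨ count-allSubsets-suc m (∈∩coNonempty? fzero) ⟩
  count (∈∩coNonempty? fzero ∘ (inside ∷_)) (allSubsets m) + count (∈∩coNonempty? fzero ∘ (outside ∷_)) (allSubsets m)
    ≡⟨ cong₂ _+_ inside-part outside-part ⟩
  (2 ^ m ∸ 1) + 0
    ≡⟨ +-identityʳ (2 ^ m ∸ 1) ⟩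
  2 ^ m ∸ 1 ∎
  where
  open ≡-Reasoning
  inside-part : count (∈∩coNonempty? fzero ∘ (inside ∷_)) (allSubsets m) ≡ 2 ^ m ∸ 1
  inside-part = trans (count-≐ (∈∩coNonempty? fzero ∘ (inside ∷_)) (nonempty? ∘ ∁)
                               (coNonempty-inside ∘ proj₂ , λ ∁B≠∅ → here , coNonempty-∷ inside ∁B≠∅) (allSubsets m))
                      (count-coNonempty m)
  outside-part : count (∈∩coNonempty? fzero ∘ (outside ∷_)) (allSubsets m) ≡ 0
  outside-part = count-none (∈∩coNonempty? fzero ∘ (outside ∷_)) (All.universal (λ { _ (() , _) }) (allSubsets m))
count-∈∩coNonempty (suc m) (fsuc l) = begin
  count (∈∩coNonempty? (fsuc l)) (allSubsets (suc (suc m)))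
    ≡⟨ count-allSubsets-suc (suc m) (∈∩coNonempty? (fsuc l)) ⟩
  count (∈∩coNonempty? (fsuc l) ∘ (inside ∷_)) (allSubsets (suc m))
    + count (∈∩coNonempty? (fsuc l) ∘ (outside ∷_)) (allSubsets (suc m))
    ≡⟨ cong₂ _+_ inside-part outside-part ⟩
  (2 ^ m ∸ 1) + 2 ^ m
    ≡⟨ 2^n∸1+2^n≡2^[1+n]∸1 m ⟩
  2 ^ suc m ∸ 1 ∎
  where
  open ≡-Reasoning
  inside-part : count (∈∩coNonempty? (fsuc l) ∘ (inside ∷_)) (allSubsets (suc m)) ≡ 2 ^ m ∸ 1
  inside-part = trans (count-≐ (∈∩coNonempty? (fsuc l) ∘ (inside ∷_)) (∈∩coNonempty? l)
                               (Product.map drop-there coNonempty-inside , Product.map there (coNonempty-∷ inside))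
                               (allSubsets (suc m)))
                      (count-∈∩coNonempty m l)
  outside-part : count (∈∩coNonempty? (fsuc l) ∘ (outside ∷_)) (allSubsets (suc m)) ≡ 2 ^ m
  outside-part = trans (count-≐ (∈∩coNonempty? (fsuc l) ∘ (outside ∷_)) (l ∈?_)
                                (drop-there ∘ proj₁ , λ l∈B → there l∈B , fzero , here) (allSubsets (suc m)))
                       (count-∈ m l)

-- Subsets saturated with respect to a map

Saturated : {N M : ℕ} → (Fin N → Fin M) → Subset N → Set
Saturated c A = ∀ i j → c i ≡ c j → lookup A i ≡ lookup A j

saturated? : {N M : ℕ} (c : Fin N → Fin M) → Decidable (Saturated c)
saturated? c A = all? λ i → all? λ j → (c i ≟ c j) →-dec (lookup A i ≟ᵇ lookup A j)

module _ {N M : ℕ} (c : Fin N → Fin M) where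

  pull : Subset M → Subset N
  pull B = tabulate (lookup B ∘ c)

  lookup-pull : ∀ B i → lookup (pull B) i ≡ lookup B (c i)
  lookup-pull B = lookup∘tabulate (lookup B ∘ c)

  pull-saturated : ∀ B → Saturated c (pull B)
  pull-saturated B i j cᵢ≡cⱼ = trans (lookup-pull B i) (trans (cong (lookup B) cᵢ≡cⱼ) (sym (lookup-pull B j)))

  pull-[]= : ∀ {B i} {b : Bool} → B [ c i ]= b → pull B [ i ]= b
  pull-[]= {B} {i} B[cᵢ]=b = lookup⇒[]= i (pull B) (trans (lookup-pull B i) ([]=⇒lookup B[cᵢ]=b))

  pull-[]=⁻ : ∀ {B i} {b : Bool} → pull B [ i ]= b → B [ c i ]= b
  pull-[]=⁻ {B} {i} pull[i]=b = lookup⇒[]= (c i) B (trans (sym (lookup-pull B i)) ([]=⇒lookup pull[i]=b))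

  ∁-pull : ∀ B → ∁ (pull B) ≡ pull (∁ B)
  ∁-pull B = trans (sym (tabulate-∘ not (lookup B ∘ c))) (tabulate-cong λ i → sym (lookup-map (c i) not B))

  module _ (sec : Fin M → Fin N) (c∘sec : c ∘ sec ≗ id) where

    pull-injective : ∀ {B B′} → pull B ≡ pull B′ → B ≡ B′
    pull-injective {B} {B′} eq = trans (sym (tabulate∘lookup B)) (trans (tabulate-cong pointwise) (tabulate∘lookup B′))
      where
      pointwise : ∀ l → lookup B l ≡ lookup B′ l
      pointwise l = begin
        lookup B l              ≡⟨ cong (lookup B) (c∘sec l) ⟨
        lookup B (c (sec l))    ≡⟨ lookup-pull B (sec l) ⟨
        lookup (pull B) (sec l) ≡⟨ cong (λ A → lookup A (sec l)) eq ⟩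
        lookup (pull B′) (sec l) ≡⟨ lookup-pull B′ (sec l) ⟩
        lookup B′ (c (sec l))   ≡⟨ cong (lookup B′) (c∘sec l) ⟩
        lookup B′ l             ∎
        where open ≡-Reasoning

    saturated⇒≡pull : ∀ {A} → Saturated c A → A ≡ pull (tabulate (lookup A ∘ sec))
    saturated⇒≡pull {A} sat = trans (sym (tabulate∘lookup A)) (tabulate-cong λ i →
      sym (trans (lookup∘tabulate (lookup A ∘ sec) (c i)) (sat (sec (c i)) i (c∘sec (c i)))))

    coNonempty-pull : ∀ {B} → Nonempty (∁ B) → Nonempty (∁ (pull B))
    coNonempty-pull {B} (l , l∈∁B) =
      sec l , subst (sec l ∈_) (sym (∁-pull B)) (pull-[]= (subst (λ l′ → ∁ B [ l′ ]= _) (sym (c∘sec l)) l∈∁B))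

  coNonempty-pull⁻ : ∀ {B} → Nonempty (∁ (pull B)) → Nonempty (∁ B)
  coNonempty-pull⁻ {B} (i , i∈∁pull) = c i , pull-[]=⁻ (subst (i ∈_) (∁-pull B) i∈∁pull)

-- pull c maps the subsets of Fin (suc m) that contain c 0 and miss some point bijectively onto
-- the saturated representatives of proper bipartitions.
count-saturated-properBips : ∀ {n m} (c : Fin (suc n) → Fin (suc m)) (sec : Fin (suc m) → Fin (suc n)) →
  c ∘ sec ≗ id → count (saturated? c) (properBips (suc n)) ≡ 2 ^ m ∸ 1
count-saturated-properBips {n} {m} c sec c∘sec = begin
  length (filter (saturated? c) (properBips (suc n)))
    ≡⟨ unique∧set⇒length≡ (Unique.filter⁺ (saturated? c) (Unique.filter⁺ isProperBipRep? (allSubsets-unique (suc n))))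
                           (Unique.map⁺ (pull-injective c sec c∘sec) (Unique.filter⁺ P? (allSubsets-unique (suc m))))
                           (mk⇔ to from) ⟩
  length (map (pull c) (filter P? (allSubsets (suc m))))
    ≡⟨ length-map (pull c) (filter P? (allSubsets (suc m))) ⟩
  count P? (allSubsets (suc m))
    ≡⟨ count-∈∩coNonempty m (c fzero) ⟩
  2 ^ m ∸ 1 ∎
  where
  open ≡-Reasoning
  P? : Decidable ((c fzero ∈_) ∩ (Nonempty ∘ ∁))
  P? = ∈∩coNonempty? (c fzero)

  to : ∀ {A} → A List.∈ filter (saturated? c) (properBips (suc n)) → A List.∈ map (pull c) (filter P? (allSubsets (suc m)))
  to {A} A∈ with ∈-filter⁻ (saturated? c) {xs = properBips (suc n)} A∈
  ... | A∈bips , sat with ∈-filter⁻ isProperBipRep? {xs = allSubsets (suc n)} A∈bips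
  ... | _ , 0∈A , _ , ∁A≠∅ = subst (List._∈ map (pull c) (filter P? (allSubsets (suc m)))) (sym A≡pullB)
        (∈-map⁺ (pull c) (∈-filter⁺ P? (∈-allSubsets B)
          (pull-[]=⁻ c (subst (fzero ∈_) A≡pullB 0∈A) , coNonempty-pull⁻ c (subst (Nonempty ∘ ∁) A≡pullB ∁A≠∅))))
    where
    B : Subset (suc m)
    B = tabulate (lookup A ∘ sec)
    A≡pullB : A ≡ pull c B
    A≡pullB = saturated⇒≡pull c sec c∘sec sat

  from : ∀ {A} → A List.∈ map (pull c) (filter P? (allSubsets (suc m))) → A List.∈ filter (saturated? c) (properBips (suc n))
  from A∈ with ∈-map⁻ (pull c) A∈
  ... | B , B∈ , refl with ∈-filter⁻ P? {xs = allSubsets (suc m)} B∈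
  ... | _ , c0∈B , ∁B≠∅ =
    ∈-filter⁺ (saturated? c)
      (∈-filter⁺ isProperBipRep? (∈-allSubsets (pull c B))
        (pull-[]= c c0∈B , (fzero , pull-[]= c c0∈B) , coNonempty-pull c sec c∘sec ∁B≠∅))
      (pull-saturated c B)

-- Merging two points

module _ {m : ℕ} {a b : Fin (suc m)} (a≢b : a ≢ b) where

  merge : Fin (suc m) → Fin m
  merge l with l ≟ a
  ... | yes _   = punchOut a≢b
  ... | no  l≢a = punchOut (l≢a ∘ sym)

  merge-≢ : ∀ {l} (l≢a : l ≢ a) → merge l ≡ punchOut (l≢a ∘ sym)
  merge-≢ {l} l≢a with l ≟ a
  ... | yes l≡a = ⊥-elim (l≢a l≡a)
  ... | no  _   = punchOut-cong a refl

  merge-a≡merge-b : merge a ≡ merge b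
  merge-a≡merge-b with a ≟ a
  ... | yes _   = sym (trans (merge-≢ (a≢b ∘ sym)) (punchOut-cong a refl))
  ... | no  a≢a = ⊥-elim (a≢a refl)

  merge-injective : ∀ {x y} → x ≢ a → y ≢ a → merge x ≡ merge y → x ≡ y
  merge-injective x≢a y≢a eq =
    punchOut-injective (x≢a ∘ sym) (y≢a ∘ sym) (trans (sym (merge-≢ x≢a)) (trans eq (merge-≢ y≢a)))

  merge-≡⁻ : ∀ x y → merge x ≡ merge y → x ≡ y ⊎ (x ≡ a ⊎ x ≡ b) × (y ≡ a ⊎ y ≡ b)
  merge-≡⁻ x y eq = cases (x ≟ a) (y ≟ a)
    where
    cases : Dec (x ≡ a) → Dec (y ≡ a) → x ≡ y ⊎ (x ≡ a ⊎ x ≡ b) × (y ≡ a ⊎ y ≡ b)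
    cases (yes x≡a) (yes y≡a) = inj₁ (trans x≡a (sym y≡a))
    cases (yes x≡a) (no  y≢a) = inj₂ (inj₁ x≡a , inj₂ (sym (merge-injective (a≢b ∘ sym) y≢a
                                  (trans (sym merge-a≡merge-b) (trans (cong merge (sym x≡a)) eq)))))
    cases (no  x≢a) (yes y≡a) = inj₂ (inj₂ (merge-injective x≢a (a≢b ∘ sym)
                                  (trans eq (trans (cong merge y≡a) merge-a≡merge-b))) , inj₁ y≡a)
    cases (no  x≢a) (no  y≢a) = inj₁ (merge-injective x≢a y≢a eq)

  merge-punchIn : ∀ l → merge (punchIn a l) ≡ l
  merge-punchIn l = trans (merge-≢ (punchInᵢ≢i a l)) (trans (punchOut-cong a refl) (punchOut-punchIn a))

-- Separation

module _ {N : ℕ} where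

  Separates : List (Subset N) → Fin N → Fin N → Set
  Separates F i j = Any (λ A → Cuts A i j) F

  separates? : ∀ F i j → Dec (Separates F i j)
  separates? F i j = Any.any? (λ A → cuts? A i j) F

  Unseparated : List (Subset N) → Fin N → Fin N → Set
  Unseparated F i j = All (λ A → lookup A i ≡ lookup A j) F

  unseparated? : ∀ F i j → Dec (Unseparated F i j)
  unseparated? F i j = All.all? (λ A → lookup A i ≟ᵇ lookup A j) F

  ¬separates⇒unseparated : ∀ {F i j} → ¬ Separates F i j → Unseparated F i j
  ¬separates⇒unseparated {F} ¬sep = All.map (decidable-stable (_ ≟ᵇ _)) (¬Any⇒All¬ F ¬sep)

  unseparated⇒¬separates : ∀ {F i j} → Unseparated F i j → ¬ Separates F i j
  unseparated⇒¬separates unsep = All¬⇒¬Any (All.map (λ Aᵢ≡Aⱼ cut → cut Aᵢ≡Aⱼ) unsep)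

  unseparated-trans : ∀ {F i j k} → Unseparated F i j → Unseparated F i k → Unseparated F j k
  unseparated-trans = curry (All.zipWith λ (Aᵢ≡Aⱼ , Aᵢ≡Aₖ) → trans (sym Aᵢ≡Aⱼ) Aᵢ≡Aₖ)

SaturatedSeparating : {N M : ℕ} → (Fin N → Fin M) → List (Fin N) → List (Subset N) → Set
SaturatedSeparating c S F = All (Saturated c) F × AllPairs (Separates F) S

saturatedSeparating? : {N M : ℕ} (c : Fin N → Fin M) (S : List (Fin N)) → Decidable (SaturatedSeparating c S)
saturatedSeparating? c S F = All.all? (saturated? c) F ×-dec AllPairs.allPairs? (separates? F) S

module _ {N M : ℕ} (c : Fin N → Fin M) (p : Fin N) (S : List (Fin N)) where

  private
    Joined : Fin N → List (Subset N) → Set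
    Joined q F = SaturatedSeparating c S F × Unseparated F p q

    joined? : ∀ q → Decidable (Joined q)
    joined? q = saturatedSeparating? c S ∩? λ F → unseparated? F p q

  saturatedSeparating-∷ : SaturatedSeparating c S ≐ (SaturatedSeparating c (p ∷ S) ∪ λ F → Any (λ q → Joined q F) S)
  saturatedSeparating-∷ = to , from
    where
    to : ∀ {F} → SaturatedSeparating c S F → SaturatedSeparating c (p ∷ S) F ⊎ Any (λ q → Joined q F) S
    to {F} (sat , seps) with All.all? (separates? F p) S
    ... | yes p-seps = inj₁ (sat , p-seps ∷ seps)
    ... | no ¬p-seps = inj₂ (Any.map (λ ¬sep → (sat , seps) , ¬separates⇒unseparated ¬sep) (¬All⇒Any¬ (separates? F p) S ¬p-seps))
    from : ∀ {F} → SaturatedSeparating c (p ∷ S) F ⊎ Any (λ q → Joined q F) S → SaturatedSeparating c S F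
    from (inj₁ (sat , _ ∷ seps)) = sat , seps
    from (inj₂ joined)           = proj₁ (proj₂ (Any.satisfied joined))

  count-saturatedSeparating-∷ : ∀ Fs → count (saturatedSeparating? c S) Fs ≡
    count (saturatedSeparating? c (p ∷ S)) Fs + sum (map (λ q → count (saturatedSeparating? c S ∩? λ F → unseparated? F p q) Fs) S)
  count-saturatedSeparating-∷ Fs = begin
    count (saturatedSeparating? c S) Fs
      ≡⟨ count-≐ (saturatedSeparating? c S) (saturatedSeparating? c (p ∷ S) ∪? anyJoined?) saturatedSeparating-∷ Fs ⟩
    count (saturatedSeparating? c (p ∷ S) ∪? anyJoined?) Fs
      ≡⟨ count-∪ (saturatedSeparating? c (p ∷ S)) anyJoined? disjoint Fs ⟩
    count (saturatedSeparating? c (p ∷ S)) Fs + count anyJoined? Fs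
      ≡⟨ cong (_+_ (count (saturatedSeparating? c (p ∷ S)) Fs)) (count-any joined? S exclusive Fs) ⟩
    count (saturatedSeparating? c (p ∷ S)) Fs + sum (map (λ q → count (joined? q) Fs) S) ∎
    where
    open ≡-Reasoning
    anyJoined? : Decidable (λ F → Any (λ q → Joined q F) S)
    anyJoined? F = Any.any? (λ q → joined? q F) S
    disjoint : ∀ {F} → SaturatedSeparating c (p ∷ S) F → ¬ Any (λ q → Joined q F) S
    disjoint (_ , p-seps ∷ _) = All¬⇒¬Any (All.map (λ sep (_ , unsep) → unseparated⇒¬separates unsep sep) p-seps)
    exclusive : ∀ {F q} → Joined q F → AllPairs (λ q₁ q₂ → ¬ (Joined q₁ F × Joined q₂ F)) S
    exclusive ((_ , seps) , _) =
      AllPairs.map (λ sep ((_ , unsep₁) , (_ , unsep₂)) → unseparated⇒¬separates (unseparated-trans unsep₁ unsep₂) sep) seps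

module _ {N m : ℕ} (c : Fin N → Fin (suc m)) {p q : Fin N} (cₚ≢c_q : c p ≢ c q) where

  private
    c′ : Fin N → Fin m
    c′ = merge cₚ≢c_q ∘ c

  saturated-merge : ∀ {A} → Saturated c′ A → Saturated c A × lookup A p ≡ lookup A q
  saturated-merge sat = (λ i j cᵢ≡cⱼ → sat i j (cong (merge cₚ≢c_q) cᵢ≡cⱼ)) , sat p q (merge-a≡merge-b cₚ≢c_q)

  saturated-merge⁻ : ∀ {A} → Saturated c A → lookup A p ≡ lookup A q → Saturated c′ A
  saturated-merge⁻ {A} sat Aₚ≡A_q i j c′ᵢ≡c′ⱼ with merge-≡⁻ cₚ≢c_q (c i) (c j) c′ᵢ≡c′ⱼ
  ... | inj₁ cᵢ≡cⱼ         = sat i j cᵢ≡cⱼ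
  ... | inj₂ (i∈pq , j∈pq) = trans (≡Aₚ i i∈pq) (sym (≡Aₚ j j∈pq))
    where
    ≡Aₚ : ∀ k → c k ≡ c p ⊎ c k ≡ c q → lookup A k ≡ lookup A p
    ≡Aₚ k (inj₁ cₖ≡cₚ) = sat k p cₖ≡cₚ
    ≡Aₚ k (inj₂ cₖ≡c_q) = trans (sat k q cₖ≡c_q) (sym Aₚ≡A_q)

  saturatedSeparating-merge : ∀ S →
    (λ F → SaturatedSeparating c S F × Unseparated F p q) ≐ SaturatedSeparating c′ S
  saturatedSeparating-merge S =
    (λ ((sats , seps) , unsep) → All.zipWith (λ {A} (sat , eq) → saturated-merge⁻ {A} sat eq) (sats , unsep) , seps) ,
    (λ (sats′ , seps) → (All.map (λ {A} → proj₁ ∘ saturated-merge {A}) sats′ , seps) , All.map (λ {A} → proj₂ ∘ saturated-merge {A}) sats′)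

  merge-distinct : ∀ {S} → AllPairs (λ i j → c i ≢ c j) S → All (λ j → c p ≢ c j) S → AllPairs (λ i j → c′ i ≢ c′ j) S
  merge-distinct []                     []                 = []
  merge-distinct (cᵢ≢cⱼs ∷ distinct) (cₚ≢cᵢ ∷ cₚ≢cⱼs) =
    All.zipWith (λ (cᵢ≢cⱼ , cₚ≢cⱼ) → cᵢ≢cⱼ ∘ merge-injective cₚ≢c_q (cₚ≢cᵢ ∘ sym) (cₚ≢cⱼ ∘ sym)) (cᵢ≢cⱼs , cₚ≢cⱼs)
    ∷ merge-distinct distinct cₚ≢cⱼs

  merge-section : (sec : Fin (suc m) → Fin N) → c ∘ sec ≗ id → c′ ∘ sec ∘ punchIn (c p) ≗ id
  merge-section sec c∘sec l = trans (cong (merge cₚ≢c_q) (c∘sec (punchIn (c p) l))) (merge-punchIn cₚ≢c_q l)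

-- Finite sums and signed Stirling numbers of the first kind

Σ< : ℕ → (ℕ → ℤ) → ℤ
Σ< n g = foldr _+ℤ_ (+ 0) (applyUpTo g n)

Σ<-cong : ∀ n {g h : ℕ → ℤ} → (∀ i → g i ≡ h i) → Σ< n g ≡ Σ< n h
Σ<-cong zero    g≗h = refl
Σ<-cong (suc n) g≗h = cong₂ _+ℤ_ (g≗h 0) (Σ<-cong n (g≗h ∘ suc))

Σ<-+ : ∀ n (g h : ℕ → ℤ) → Σ< n (λ i → g i +ℤ h i) ≡ Σ< n g +ℤ Σ< n h
Σ<-+ zero    g h = refl
Σ<-+ (suc n) g h = trans (cong (g 0 +ℤ h 0 +ℤ_) (Σ<-+ n (g ∘ suc) (h ∘ suc)))
  (solve 4 (λ a b x y → (a :+ b) :+ (x :+ y) := (a :+ x) :+ (b :+ y)) refl (g 0) (h 0) (Σ< n (g ∘ suc)) (Σ< n (h ∘ suc)))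
  where open +-*-Solver

*-Σ< : ∀ n x (g : ℕ → ℤ) → x *ℤ Σ< n g ≡ Σ< n (λ i → x *ℤ g i)
*-Σ< zero    x g = ℤ.*-zeroʳ x
*-Σ< (suc n) x g = trans (ℤ.*-distribˡ-+ x (g 0) (Σ< n (g ∘ suc))) (cong (x *ℤ g 0 +ℤ_) (*-Σ< n x (g ∘ suc)))

Σ<-last : ∀ n (g : ℕ → ℤ) → Σ< (suc n) g ≡ Σ< n g +ℤ g n
Σ<-last zero    g = trans (ℤ.+-identityʳ (g 0)) (sym (ℤ.+-identityˡ (g 0)))
Σ<-last (suc n) g = trans (cong (g 0 +ℤ_) (Σ<-last n (g ∘ suc))) (sym (ℤ.+-assoc (g 0) (Σ< n (g ∘ suc)) (g (suc n))))

stirling1-> : ∀ {n k} → n < k → stirling1 n k ≡ 0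
stirling1-> {zero}  {suc k} _         = refl
stirling1-> {suc n} {suc k} (s≤s n<k) =
  cong₂ _+_ (trans (cong (n *_) (stirling1-> (m<n⇒m<1+n n<k))) (*-zeroʳ n)) (stirling1-> n<k)

∸-suc-< : ∀ {n k} → k < n → n ∸ k ≡ suc (n ∸ suc k)
∸-suc-< {suc n} {zero}  _         = refl
∸-suc-< {suc n} {suc k} (s≤s k<n) = ∸-suc-< k<n

signedStirling1 : ℕ → ℕ → ℤ
signedStirling1 n k = -1ℤ ^ℤ (n ∸ k) *ℤ + stirling1 n k

signedStirling1-suc-zero : ∀ n → signedStirling1 (suc n) 0 ≡ + 0
signedStirling1-suc-zero n = ℤ.*-zeroʳ (-1ℤ ^ℤ suc n)

signedStirling1-> : ∀ {n k} → n < k → signedStirling1 n k ≡ + 0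
signedStirling1-> {n} {k} n<k =
  trans (cong (λ a → -1ℤ ^ℤ (n ∸ k) *ℤ + a) (stirling1-> n<k)) (ℤ.*-zeroʳ (-1ℤ ^ℤ (n ∸ k)))

signedStirling1-suc : ∀ n k →
  signedStirling1 (suc n) (suc k) +ℤ + n *ℤ signedStirling1 n (suc k) ≡ signedStirling1 n k
signedStirling1-suc n k with <-≤-connex k n
... | inj₁ k<n = begin
  signedStirling1 (suc n) (suc k) +ℤ + n *ℤ signedStirling1 n (suc k)
    ≡⟨ cong₂ (λ ε x → ε *ℤ x +ℤ + n *ℤ signedStirling1 n (suc k)) (cong (-1ℤ ^ℤ_) (∸-suc-< k<n))
             (trans (ℤ.pos-+ (n * a) b) (cong (_+ℤ + b) (ℤ.pos-* n a))) ⟩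
  -1ℤ *ℤ ε *ℤ (+ n *ℤ + a +ℤ + b) +ℤ + n *ℤ (ε *ℤ + a)
    ≡⟨ solve 4 (λ ε N A B → con -1ℤ :* ε :* (N :* A :+ B) :+ N :* (ε :* A) := con -1ℤ :* ε :* B) refl ε (+ n) (+ a) (+ b) ⟩
  -1ℤ *ℤ ε *ℤ + b
    ≡⟨ cong (λ e → -1ℤ ^ℤ e *ℤ + b) (∸-suc-< k<n) ⟨
  signedStirling1 n k ∎
  where
  open ≡-Reasoning
  open +-*-Solver
  ε : ℤ
  ε = -1ℤ ^ℤ (n ∸ suc k)
  a b : ℕ
  a = stirling1 n (suc k)
  b = stirling1 n k
... | inj₂ n≤k = begin
  signedStirling1 (suc n) (suc k) +ℤ + n *ℤ signedStirling1 n (suc k)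
    ≡⟨ cong₂ (λ x y → -1ℤ ^ℤ (n ∸ k) *ℤ + x +ℤ + n *ℤ y)
             (trans (cong (λ a → n * a + stirling1 n k) (stirling1-> (s≤s n≤k))) (cong (_+ stirling1 n k) (*-zeroʳ n)))
             (signedStirling1-> (s≤s n≤k)) ⟩
  signedStirling1 n k +ℤ + n *ℤ + 0
    ≡⟨ cong (signedStirling1 n k +ℤ_) (ℤ.*-zeroʳ (+ n)) ⟩
  signedStirling1 n k +ℤ + 0
    ≡⟨ ℤ.+-identityʳ (signedStirling1 n k) ⟩
  signedStirling1 n k ∎
  where open ≡-Reasoning

stirlingSum : ℕ → (ℕ → ℤ) → ℤ
stirlingSum j g = Σ< (suc j) (λ i → signedStirling1 j i *ℤ g i)

stirlingSum-cong : ∀ j {g h : ℕ → ℤ} → (∀ i → g i ≡ h i) → stirlingSum j g ≡ stirlingSum j h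
stirlingSum-cong j g≗h = Σ<-cong (suc j) (λ i → cong (signedStirling1 j i *ℤ_) (g≗h i))

stirlingSum-zero : ∀ g → stirlingSum 0 g ≡ g 0
stirlingSum-zero g = trans (ℤ.+-identityʳ (1ℤ *ℤ g 0)) (ℤ.*-identityˡ (g 0))

*-stirlingSum : ∀ j g → + j *ℤ stirlingSum j g ≡ + j *ℤ Σ< (suc j) (λ i → signedStirling1 j (suc i) *ℤ g (suc i))
*-stirlingSum zero    g = refl
*-stirlingSum (suc j) g = cong (+ suc j *ℤ_) (begin
  signedStirling1 (suc j) 0 *ℤ g 0 +ℤ T
    ≡⟨ cong (λ x → x *ℤ g 0 +ℤ T) (signedStirling1-suc-zero j) ⟩
  + 0 +ℤ T
    ≡⟨ ℤ.+-identityˡ T ⟩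
  T
    ≡⟨ ℤ.+-identityʳ T ⟨
  T +ℤ + 0
    ≡⟨ cong (T +ℤ_) (cong (_*ℤ g (2 + j)) (signedStirling1-> (n<1+n (suc j)))) ⟨
  T +ℤ signedStirling1 (suc j) (2 + j) *ℤ g (2 + j)
    ≡⟨ Σ<-last (suc j) (λ i → signedStirling1 (suc j) (suc i) *ℤ g (suc i)) ⟨
  Σ< (2 + j) (λ i → signedStirling1 (suc j) (suc i) *ℤ g (suc i)) ∎)
  where
  open ≡-Reasoning
  T : ℤ
  T = Σ< (suc j) (λ i → signedStirling1 (suc j) (suc i) *ℤ g (suc i))

stirlingSum-suc : ∀ j g → stirlingSum (suc j) g +ℤ + j *ℤ stirlingSum j g ≡ stirlingSum j (g ∘ suc)
stirlingSum-suc j g = begin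
  stirlingSum (suc j) g +ℤ + j *ℤ stirlingSum j g
    ≡⟨ cong₂ _+ℤ_ (trans (cong (λ x → x *ℤ g 0 +ℤ Σ< (suc j) t) (signedStirling1-suc-zero j)) (ℤ.+-identityˡ (Σ< (suc j) t)))
                  (trans (*-stirlingSum j g) (*-Σ< (suc j) (+ j) u)) ⟩
  Σ< (suc j) t +ℤ Σ< (suc j) (λ i → + j *ℤ u i)
    ≡⟨ Σ<-+ (suc j) t (λ i → + j *ℤ u i) ⟨
  Σ< (suc j) (λ i → t i +ℤ + j *ℤ u i)
    ≡⟨ Σ<-cong (suc j) termwise ⟩
  stirlingSum j (g ∘ suc) ∎
  where
  open ≡-Reasoning
  t u : ℕ → ℤ
  t i = signedStirling1 (suc j) (suc i) *ℤ g (suc i)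
  u i = signedStirling1 j (suc i) *ℤ g (suc i)
  termwise : ∀ i → t i +ℤ + j *ℤ u i ≡ signedStirling1 j i *ℤ g (suc i)
  termwise i = trans (solve 4 (λ A J B x → A :* x :+ J :* (B :* x) := (A :+ J :* B) :* x) refl
                              (signedStirling1 (suc j) (suc i)) (+ j) (signedStirling1 j (suc i)) (g (suc i)))
                     (cong (_*ℤ g (suc i)) (signedStirling1-suc j i))
    where open +-*-Solver

-- Counting separating families

-- The number of k-families of proper bipartitions of an r-element set (r ≥ 1).
familiesOf : ℕ → ℕ → ℤ
familiesOf k r = + ((2 ^ (r ∸ 1) ∸ 1) C k)

module _ (n k : ℕ) where

  families : List (List (Subset (suc n)))
  families = combinations k (properBips (suc n))

  count-saturatedSeparating : ∀ S r {m} (c : Fin (suc n) → Fin m) (sec : Fin m → Fin (suc n)) → c ∘ sec ≗ id →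
    m ≡ length S + r → AllPairs (λ i j → c i ≢ c j) S →
    + count (saturatedSeparating? c S) families ≡ stirlingSum (length S) (λ i → familiesOf k (r + i))
  count-saturatedSeparating S r {zero} c _ _ _ _ = ⊥-elim (¬Fin0 (c fzero))
  count-saturatedSeparating [] .(suc m) {suc m} c sec c∘sec refl [] = begin
    + count (saturatedSeparating? c []) families
      ≡⟨ cong +_ (count-≐ (saturatedSeparating? c []) (All.all? (saturated? c)) (proj₁ , (_, [])) families) ⟩
    + count (All.all? (saturated? c)) families
      ≡⟨ cong +_ (count-combinations (saturated? c) k (properBips (suc n))) ⟩
    + (count (saturated? c) (properBips (suc n)) C k)
      ≡⟨ cong (λ x → + (x C k)) (count-saturated-properBips c sec c∘sec) ⟩
    familiesOf k (suc m)
      ≡⟨ cong (familiesOf k) (+-identityʳ (suc m)) ⟨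
    familiesOf k (suc m + 0)
      ≡⟨ stirlingSum-zero (λ i → familiesOf k (suc m + i)) ⟨
    stirlingSum 0 (λ i → familiesOf k (suc m + i)) ∎
    where open ≡-Reasoning
  count-saturatedSeparating (p ∷ S) r {suc m} c sec c∘sec m≡ (cₚ≢c[S] ∷ distinct) =
    ∙-cancelʳ (+ j *ℤ stirlingSum j g) _ _ (begin
      + count (saturatedSeparating? c (p ∷ S)) families +ℤ + j *ℤ stirlingSum j g
        ≡⟨ cong (+ count (saturatedSeparating? c (p ∷ S)) families +ℤ_) (sum-map-const counted merged) ⟨
      + count (saturatedSeparating? c (p ∷ S)) families +ℤ + sum (map counted S)
        ≡⟨ ℤ.pos-+ (count (saturatedSeparating? c (p ∷ S)) families) (sum (map counted S)) ⟨
      + (count (saturatedSeparating? c (p ∷ S)) families + sum (map counted S))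
        ≡⟨ cong +_ (count-saturatedSeparating-∷ c p S families) ⟨
      + count (saturatedSeparating? c S) families
        ≡⟨ count-saturatedSeparating S (suc r) c sec c∘sec (trans m≡ (sym (+-suc j r))) distinct ⟩
      stirlingSum j (λ i → familiesOf k (suc r + i))
        ≡⟨ stirlingSum-cong j (λ i → cong (familiesOf k) (+-suc r i)) ⟨
      stirlingSum j (g ∘ suc)
        ≡⟨ stirlingSum-suc j g ⟨
      stirlingSum (suc j) g +ℤ + j *ℤ stirlingSum j g ∎)
    where
    open ≡-Reasoning
    j : ℕ
    j = length S
    g : ℕ → ℤ
    g i = familiesOf k (r + i)
    counted : Fin (suc n) → ℕ
    counted q = count (saturatedSeparating? c S ∩? λ F → unseparated? F p q) families
    merged : All (λ q → + counted q ≡ stirlingSum j g) S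
    merged = All.map one cₚ≢c[S]
      where
      one : ∀ {q} → c p ≢ c q → + counted q ≡ stirlingSum j g
      one {q} cₚ≢c_q = trans
        (cong +_ (count-≐ _ (saturatedSeparating? _ S) (saturatedSeparating-merge c cₚ≢c_q S) families))
        (count-saturatedSeparating S r _ (sec ∘ punchIn (c p)) (merge-section c cₚ≢c_q sec c∘sec)
          (suc-injective m≡) (merge-distinct c cₚ≢c_q distinct cₚ≢c[S]))

separates-sym : ∀ {N} {F : List (Subset N)} {i j} → Separates F i j → Separates F j i
separates-sym = Any.map (λ cut Aⱼ≡Aᵢ → cut (sym Aⱼ≡Aᵢ))

separating≐saturatedSeparating : ∀ {N} → Separating ≐ SaturatedSeparating id (allFin N)
separating≐saturatedSeparating =
  (λ {F} sep → All.universal (λ A _ _ → cong (lookup A)) F , AllPairs.tabulate⁺ (λ {i} {j} → sep i j)) ,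
  (λ (_ , seps) i j i≢j → allPairs-∈ separates-sym seps (∈-allFin i) (∈-allFin j) i≢j)

-- The terms i = 0, 1 vanish because familiesOf (suc k) is 0 at 0 and 1 (this is where k ≥ 1 is
-- used); the right-hand side unfolds to Σ< n (G ∘ suc) for the G below.
stirlingSum-familiesOf : ∀ n k → stirlingSum (suc n) (familiesOf (suc k)) ≡
  sumFromTo 1 n (λ i → (-1ℤ ^ℤ (n ∸ i)) *ℤ (+ stirling1 (suc n) (i + 1) *ℤ + ((2 ^ i ∸ 1) C suc k)))
stirlingSum-familiesOf n k = begin
  signedStirling1 (suc n) 0 *ℤ + 0 +ℤ (signedStirling1 (suc n) 1 *ℤ + 0 +ℤ Σ< n (h ∘ suc ∘ suc))
    ≡⟨ cong₂ (λ x y → x +ℤ (y +ℤ Σ< n (h ∘ suc ∘ suc))) (ℤ.*-zeroʳ (signedStirling1 (suc n) 0)) (ℤ.*-zeroʳ (signedStirling1 (suc n) 1)) ⟩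
  + 0 +ℤ (+ 0 +ℤ Σ< n (h ∘ suc ∘ suc))
    ≡⟨ trans (ℤ.+-identityˡ (+ 0 +ℤ Σ< n (h ∘ suc ∘ suc))) (ℤ.+-identityˡ (Σ< n (h ∘ suc ∘ suc))) ⟩
  Σ< n (h ∘ suc ∘ suc)
    ≡⟨ Σ<-cong n termwise ⟩
  Σ< n (G ∘ suc) ∎
  where
  open ≡-Reasoning
  h G : ℕ → ℤ
  h t = signedStirling1 (suc n) t *ℤ familiesOf (suc k) t
  G t = (-1ℤ ^ℤ (n ∸ t)) *ℤ (+ stirling1 (suc n) (t + 1) *ℤ + ((2 ^ t ∸ 1) C suc k))
  termwise : ∀ t → h (2 + t) ≡ G (suc t)
  termwise t = trans (ℤ.*-assoc (-1ℤ ^ℤ (n ∸ suc t)) (+ stirling1 (suc n) (2 + t)) (familiesOf (suc k) (2 + t)))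
                     (cong (λ e → (-1ℤ ^ℤ (n ∸ suc t)) *ℤ (+ stirling1 (suc n) e *ℤ familiesOf (suc k) (2 + t))) (+-comm 1 (suc t)))

theorem3p15 : (n k : ℕ) → 2 ≤ n → 1 ≤ k → k < 2 ^ (n ∸ 1) →
  + σ n k ≡ sumFromTo 1 (n ∸ 1) (λ i →
    (-1ℤ ^ℤ (n ∸ 1 ∸ i)) *ℤ (+ stirling1 n (i + 1) *ℤ + ((2 ^ i ∸ 1) C k)))
theorem3p15 (suc (suc n)) (suc k) (s≤s (s≤s z≤n)) (s≤s z≤n) _ = begin
  + σ (2 + n) (suc k)
    ≡⟨ cong +_ (count-≐ separating? (saturatedSeparating? id (allFin (2 + n))) separating≐saturatedSeparating (families (suc n) (suc k))) ⟩
  + count (saturatedSeparating? id (allFin (2 + n))) (families (suc n) (suc k))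
    ≡⟨ count-saturatedSeparating (suc n) (suc k) (allFin (2 + n)) 0 id id (λ _ → refl)
         (sym (trans (+-identityʳ (length (allFin (2 + n)))) (length-tabulate id))) (AllPairs.tabulate⁺ id) ⟩
  stirlingSum (length (allFin (2 + n))) (familiesOf (suc k))
    ≡⟨ cong (λ l → stirlingSum l (familiesOf (suc k))) (length-tabulate {n = 2 + n} id) ⟩
  stirlingSum (2 + n) (familiesOf (suc k))
    ≡⟨ stirlingSum-familiesOf (suc n) k ⟩
  sumFromTo 1 (suc n) (λ i → (-1ℤ ^ℤ (suc n ∸ i)) *ℤ (+ stirling1 (2 + n) (i + 1) *ℤ + ((2 ^ i ∸ 1) C suc k))) ∎
  where open ≡-Reasoning
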